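{- Let $\chi$ be a proper edge-coloring of the complete graph $G=K_n$, let $X_1,X_2,X_3,X_4$ be a partition of $V(G)$, and let $\mathcal{G}$ be the auxiliary bipartite graph defined below. Then for any vertex $S$ of $\mathcal{G}$ and any vertex $v$ of $G$, there is at most one vertex $T$ of $\mathcal{G}$ such that $ST$ is an edge of $\mathcal{G}$ and $v$ is one of the two coordinates of $T$.
   Context: The auxiliary graph $\mathcal{G}$ is the bipartite graph with vertex set $(X_1\times X_2)\cup(X_3\times X_4)$, in which $(x_1,x_2)\in X_1\times X_2$ is adjacent to $(x_3,x_4)\in X_3\times X_4$ if and only if the edges $x_1x_3$ and $x_2x_4$ of $G$ have the same color under $\chi$ (i.e. $\{x_1x_3,x_2x_4\}$ is a monochromatic matching). A vertex $T=(a,b)$ of $\mathcal{G}$ is said to contain the vertices $a$ and $b$ of $G$. -}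

module Defs where

open import Data.Nat using (ℕ)
open import Data.Fin using (Fin; zero; suc)
open import Data.Product using (_×_; _,_; proj₁; proj₂; Σ)
open import Data.Sum using (_⊎_; inj₁; inj₂)
open import Relation.Binary.PropositionalEquality using (_≡_; _≢_)

-- The colour of edge uv is χ u v; only its
-- values on pairs u ≢ v matter, and it must be symmetric on those.
IsEdgeColouring : ∀ {n} {C : Set} → (Fin n → Fin n → C) → Set
IsEdgeColouring {n} χ = ∀ (u v : Fin n) → u ≢ v → χ u v ≡ χ v u

IsProper : ∀ {n} {C : Set} → (Fin n → Fin n → C) → Set
IsProper {n} χ = ∀ (u v w : Fin n) → u ≢ v → u ≢ w → v ≢ w → χ u v ≢ χ u w

-- A partition of V(G) into X₁,X₂,X₃,X₄ is given by a map part : Fin n → Fin 4;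
-- Xᵢ = part ⁻¹(i-1).  (Parts may be empty.)
X₁ X₂ X₃ X₄ : Fin 4
X₁ = zero
X₂ = suc zero
X₃ = suc (suc zero)
X₄ = suc (suc (suc zero))

Left : ∀ {n} → (Fin n → Fin 4) → Set
Left {n} part = Σ (Fin n × Fin n) λ p → part (proj₁ p) ≡ X₁ × part (proj₂ p) ≡ X₂

Right : ∀ {n} → (Fin n → Fin 4) → Set
Right {n} part = Σ (Fin n × Fin n) λ p → part (proj₁ p) ≡ X₃ × part (proj₂ p) ≡ X₄

AuxVertex : ∀ {n} → (Fin n → Fin 4) → Set
AuxVertex part = Left part ⊎ Right part

coords : ∀ {n} {part : Fin n → Fin 4} → AuxVertex part → Fin n × Fin n
coords (inj₁ (p , _)) = p
coords (inj₂ (p , _)) = p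

Contains : ∀ {n} {part : Fin n → Fin 4} → AuxVertex part → Fin n → Set
Contains T v = v ≡ proj₁ (coords T) ⊎ v ≡ proj₂ (coords T)

LRAdj : ∀ {n} {C : Set} → (Fin n → Fin n → C) → Fin n × Fin n → Fin n × Fin n → Set
LRAdj χ (x₁ , x₂) (x₃ , x₄) = χ x₁ x₃ ≡ χ x₂ x₄

data Adj {n} {C : Set} (χ : Fin n → Fin n → C) (part : Fin n → Fin 4) :
         AuxVertex part → AuxVertex part → Set where
  lr : (S : Left part) (T : Right part) → LRAdj χ (proj₁ S) (proj₁ T) →
       Adj χ part (inj₁ S) (inj₂ T)
  rl : (S : Right part) (T : Left part) → LRAdj χ (proj₁ T) (proj₁ S) →
       Adj χ part (inj₂ S) (inj₁ T)

-- If T and T′ are neighbours of S that both contain v, then v is the same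
-- coordinate of both (the two coordinates of a vertex of 𝒢 lie in different
-- parts), so T and T′ share an edge of their monochromatic matching with S.
-- The other two edges of these matchings meet at a vertex of S and have the
-- same colour, so properness makes them equal. The case S ∈ X₃ × X₄ is the
-- case S ∈ X₁ × X₂ for the transposed colouring.
module Submission where

open import Defs
open import Data.Nat using (ℕ)
open import Data.Fin using (Fin)
open import Data.Fin.Properties using (_≟_)
open import Data.Product using (_×_; _,_; proj₁; proj₂; Σ)
open import Data.Sum using (_⊎_; inj₁; inj₂)
open import Function using (flip)
open import Relation.Nullary using (yes; no; contradiction)
open import Relation.Binary.PropositionalEquality
open import Axiom.UniquenessOfIdentityProofs using (module Decidable⇒UIP)

module _ {n : ℕ} {C : Set} {χ : Fin n → Fin n → C} where

  proper⇒colour-injective : IsProper χ → ∀ {u a b} → u ≢ a → u ≢ b →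
    χ u a ≡ χ u b → a ≡ b
  proper⇒colour-injective proper {u} {a} {b} u≢a u≢b χua≡χub with a ≟ b
  ... | yes a≡b = a≡b
  ... | no a≢b = contradiction χua≡χub (proper u a b u≢a u≢b a≢b)

  proper⇒flip-proper : IsEdgeColouring χ → IsProper χ → IsProper (flip χ)
  proper⇒flip-proper symmetric proper u v w u≢v u≢w v≢w χvu≡χwu =
    proper u v w u≢v u≢w v≢w
      (trans (symmetric u v u≢v) (trans χvu≡χwu (symmetric w u (≢-sym u≢w))))

  matching-unique : IsProper χ → ∀ {s₁ s₂ t₁ t₂ t₁′ t₂′} →
    s₁ ≢ t₁ → s₁ ≢ t₁′ → s₂ ≢ t₂ → s₂ ≢ t₂′ →
    LRAdj χ (s₁ , s₂) (t₁ , t₂) → LRAdj χ (s₁ , s₂) (t₁′ , t₂′) →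
    t₁ ≡ t₁′ ⊎ t₂ ≡ t₂′ → (t₁ , t₂) ≡ (t₁′ , t₂′)
  matching-unique proper _ _ s₂≢t₂ s₂≢t₂′ adj adj′ (inj₁ refl) =
    cong (_ ,_) (proper⇒colour-injective proper s₂≢t₂ s₂≢t₂′ (trans (sym adj) adj′))
  matching-unique proper s₁≢t₁ s₁≢t₁′ _ _ adj adj′ (inj₂ refl) =
    cong (_, _) (proper⇒colour-injective proper s₁≢t₁ s₁≢t₁′ (trans adj (sym adj′)))

module _ {n : ℕ} (part : Fin n → Fin 4) where

  PartPair : Fin 4 → Fin 4 → Set
  PartPair i j = Σ (Fin n × Fin n) λ p → part (proj₁ p) ≡ i × part (proj₂ p) ≡ j

  _∈ᴾ_ : ∀ {i j} → Fin n → PartPair i j → Set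
  v ∈ᴾ ((a , b) , _) = v ≡ a ⊎ v ≡ b

  different-parts⇒≢ : ∀ {a b i j} → part a ≡ i → part b ≡ j → i ≢ j → a ≢ b
  different-parts⇒≢ pa≡i pb≡j i≢j refl = i≢j (trans (sym pa≡i) pb≡j)

  PartPair-≡ : ∀ {i j} {P Q : PartPair i j} → proj₁ P ≡ proj₁ Q → P ≡ Q
  PartPair-≡ {P = p , a , b} {Q = .p , c , d} refl =
    cong₂ (λ x y → p , x , y) (irrelevant a c) (irrelevant b d)
    where irrelevant = Decidable⇒UIP.≡-irrelevant _≟_

  common-vertex⇒common-coordinate : ∀ {i j} {v} (P Q : PartPair i j) → i ≢ j →
    v ∈ᴾ P → v ∈ᴾ Q → proj₁ (proj₁ P) ≡ proj₁ (proj₁ Q) ⊎ proj₂ (proj₁ P) ≡ proj₂ (proj₁ Q)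
  common-vertex⇒common-coordinate _ _ _ (inj₁ refl) (inj₁ refl) = inj₁ refl
  common-vertex⇒common-coordinate _ _ _ (inj₂ refl) (inj₂ refl) = inj₂ refl
  common-vertex⇒common-coordinate ((_ , _) , pa , _) ((_ , _) , _ , qb) i≢j (inj₁ refl) (inj₂ refl) =
    contradiction refl (different-parts⇒≢ pa qb i≢j)
  common-vertex⇒common-coordinate ((_ , _) , _ , pb) ((_ , _) , qa , _) i≢j (inj₂ refl) (inj₁ refl) =
    contradiction refl (different-parts⇒≢ pb qa (≢-sym i≢j))

  neighbour-containing-unique : ∀ {C : Set} {χ : Fin n → Fin n → C} → IsProper χ →
    ∀ {i j k l v} → i ≢ k → j ≢ l → k ≢ l →
    (S : PartPair i j) (T T′ : PartPair k l) →
    LRAdj χ (proj₁ S) (proj₁ T) → LRAdj χ (proj₁ S) (proj₁ T′) →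
    v ∈ᴾ T → v ∈ᴾ T′ → T ≡ T′
  neighbour-containing-unique proper i≢k j≢l k≢l
    (_ , s₁∈i , s₂∈j) T@(_ , t₁∈k , t₂∈l) T′@(_ , t₁′∈k , t₂′∈l) adj adj′ v∈T v∈T′ =
    PartPair-≡ (matching-unique proper
      (different-parts⇒≢ s₁∈i t₁∈k i≢k) (different-parts⇒≢ s₁∈i t₁′∈k i≢k)
      (different-parts⇒≢ s₂∈j t₂∈l j≢l) (different-parts⇒≢ s₂∈j t₂′∈l j≢l)
      adj adj′ (common-vertex⇒common-coordinate T T′ k≢l v∈T v∈T′))

lemma2p2 : (n : ℕ) (C : Set) (χ : Fin n → Fin n → C) → IsEdgeColouring χ → IsProper χ →
    (part : Fin n → Fin 4) → (S : AuxVertex part) (v : Fin n) →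
    (T T′ : AuxVertex part) →
    Adj χ part S T → Contains T v → Adj χ part S T′ → Contains T′ v →
    T ≡ T′
lemma2p2 n C χ _ proper part _ v _ _ (lr S T adj) v∈T (lr _ T′ adj′) v∈T′ =
  cong inj₂ (neighbour-containing-unique part proper (λ ()) (λ ()) (λ ()) S T T′ adj adj′ v∈T v∈T′)
lemma2p2 n C χ symmetric proper part _ v _ _ (rl S T adj) v∈T (rl _ T′ adj′) v∈T′ =
  cong inj₁ (neighbour-containing-unique part (proper⇒flip-proper symmetric proper)
    (λ ()) (λ ()) (λ ()) S T T′ adj adj′ v∈T v∈T′)
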